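{- Let $\mathbf v=(1,2,2^2,\dots,2^{n-1})\in\mathbb{R}^n$. Then the affine hyperplane $H_{\mathbf v}$ is generic with respect to the arrangement $\mathcal{D}_n$. Moreover, for all $(\omega,\epsilon)\in D_n$, $\widetilde R_{\omega,\epsilon}\cap H_{\mathbf v}$ is nonempty and bounded if and only if $\omega(1)\ne n$ and all right-to-left maxima of $(\omega,\epsilon)$ are unbarred.
   Context: $\mathcal{D}_n$ is the arrangement in $\mathbb{R}^n$ of the hyperplanes $x_i=x_j$ and $x_i=-x_j$, $1\le i<j\le n$. $H_{\mathbf v}=\{\mathbf x:\mathbf v\cdot\mathbf x=\mathbf v\cdot\mathbf v\}$. An affine hyperplane $H$ is generic with respect to an arrangement if $\dim(H\cap X)=\dim X-1$ for every intersection $X$ of a subfamily of its hyperplanes. $D_n$ is the set of signed permutations $(\omega,\epsilon)$ ($\omega\in S_n$, $\epsilon\in\{ -1,1\}^n$, $\omega(i)$ barred iff $\epsilon_i=-1$) with an even number of bars. $\widetilde R_{\omega,\epsilon}=\{\mathbf x:|x_{\omega(1)}|<\epsilon_2x_{\omega(2)}<\dots<\epsilon_nx_{\omega(n)}\}$. $\omega(i)$ is a right-to-left maximum if $\omega(i)>\omega(j)$ for all $j>i$.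
   Formalization: Points lie in ℚ^n rather than $\mathbb{R}^n$, so the hyperplane $H_{\mathbf v}$, the intersections of hyperplanes of $\mathcal{D}_n$ and the regions $\widetilde R_{\omega,\epsilon}$ consist of rational points. -}

module Defs where

open import Data.Nat as ℕ using (ℕ; zero; suc)
open import Data.Nat.Divisibility using (_∣_)
open import Data.Fin using (Fin; toℕ; fromℕ)
import Data.Fin as F
open import Data.Bool using (Bool; true; false; if_then_else_)
open import Data.Rational as ℚ using (ℚ; 0ℚ; 1ℚ; _+_; _*_; -_; _-_; ∣_∣; _<_; _≤_)
open import Data.Product using (Σ; ∃; _×_; _,_)
open import Data.List using (List)
open import Data.List.Relation.Unary.All using (All)
open import Data.Fin.Permutation using (Permutation′; _⟨$⟩ʳ_)
open import Relation.Binary.PropositionalEquality using (_≡_; _≢_)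
open import Relation.Nullary using (¬_)

Point : ℕ → Set
Point n = Fin n → ℚ

sumF : ∀ {n} → (Fin n → ℚ) → ℚ
sumF {zero}  f = 0ℚ
sumF {suc n} f = f F.zero + sumF (λ i → f (F.suc i))

_·_ : ∀ {n} → Point n → Point n → ℚ
x · y = sumF (λ i → x i * y i)

pow2 : ℕ → ℚ
pow2 zero    = 1ℚ
pow2 (suc k) = (1ℚ + 1ℚ) * pow2 k

vvec : (n : ℕ) → Point n
vvec n i = pow2 (toℕ i)

H : ∀ {n} → Point n → Point n → Set
H w x = w · x ≡ w · w

-- The arrangement D_n : hyperplanes x_i = x_j (sign false) and
-- x_i = - x_j (sign true), for i < j.
record DHyp (n : ℕ) : Set where
  constructor dhyp
  field
    i j  : Fin n
    i<j  : toℕ i ℕ.< toℕ j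
    sign : Bool

onDHyp : ∀ {n} → DHyp n → Point n → Set
onDHyp (dhyp i j _ s) x = x i ≡ (if s then - x j else x j)

-- intersection X of a subfamily (a list of hyperplanes of D_n;
-- the empty subfamily gives the whole space)
Inter : ∀ {n} → List (DHyp n) → Point n → Set
Inter fam x = All (λ h → onDHyp h x) fam

AffIndep : ∀ {n m} → (Fin m → Point n) → Set
AffIndep {n} {m} p =
  (c : Fin m → ℚ) → sumF c ≡ 0ℚ →
  (∀ (i : Fin n) → sumF (λ k → c k * p k i) ≡ 0ℚ) →
  ∀ k → c k ≡ 0ℚ

HasAffIndep : ∀ {n} → (Point n → Set) → ℕ → Set
HasAffIndep {n} S m = Σ (Fin m → Point n) λ p → (∀ k → S (p k)) × AffIndep p

-- DimPlusOne S d :  dim S = d - 1, i.e. the maximal number of affinely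
-- independent points of S is d  (so the empty set has dimension -1).
DimPlusOne : ∀ {n} → (Point n → Set) → ℕ → Set
DimPlusOne S d = HasAffIndep S d × ¬ HasAffIndep S (suc d)

_∩_ : ∀ {n} → (Point n → Set) → (Point n → Set) → Point n → Set
(A ∩ B) x = A x × B x

GenericDn : (n : ℕ) → (Point n → Set) → Set
GenericDn n Hyp = (fam : List (DHyp n)) (d : ℕ) →
  DimPlusOne (Inter fam) (suc d) → DimPlusOne (Hyp ∩ Inter fam) d

-- Signed permutations (ω , ε): ε k = true means ω(k) is barred (ε_k = -1).
numBars : ∀ {n} → (Fin n → Bool) → ℕ
numBars {zero}  ε = zero
numBars {suc n} ε = (if ε F.zero then 1 else 0) ℕ.+ numBars (λ k → ε (F.suc k))

InDn : ∀ {n} → Permutation′ n → (Fin n → Bool) → Set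
InDn ω ε = 2 ∣ numBars ε

signedCoord : ∀ {n} → Permutation′ n → (Fin n → Bool) → Point n → Fin n → ℚ
signedCoord ω ε x k = if ε k then - x (ω ⟨$⟩ʳ k) else x (ω ⟨$⟩ʳ k)

-- the term at (0-based) position k of the chain
--   |x_{ω(1)}| < ε_2 x_{ω(2)} < ... < ε_n x_{ω(n)}
chainTerm : ∀ {n} → Permutation′ n → (Fin n → Bool) → Point n → Fin n → ℚ
chainTerm ω ε x F.zero    = ∣ x (ω ⟨$⟩ʳ F.zero) ∣
chainTerm ω ε x (F.suc k) = signedCoord ω ε x (F.suc k)

Region : ∀ {n} → Permutation′ n → (Fin n → Bool) → Point n → Set
Region {n} ω ε x = (k l : Fin n) → toℕ l ≡ suc (toℕ k) →
  chainTerm ω ε x k < chainTerm ω ε x l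

Nonempty : ∀ {n} → (Point n → Set) → Set
Nonempty {n} S = Σ (Point n) S

Bounded : ∀ {n} → (Point n → Set) → Set
Bounded {n} S = Σ ℚ λ B → (x : Point n) → S x → (i : Fin n) → ∣ x i ∣ ≤ B

RLMax : ∀ {n} → Permutation′ n → Fin n → Set
RLMax {n} ω k = (l : Fin n) → toℕ k ℕ.< toℕ l → toℕ (ω ⟨$⟩ʳ l) ℕ.< toℕ (ω ⟨$⟩ʳ k)

module Submission where

-- The flats of D_n are cut out by equations x_a = ±x_b, so they are linear subspaces closed
-- under applying one odd function to every coordinate. If u is a nonzero point of a flat,
-- keeping only the coordinates with |u_j| = |u_i| gives a point w of the flat with entries in
-- {-t, 0, t}; against the weights 2^j its top nonzero entry dominates, so v · w ≠ 0. Hence no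
-- nonzero flat is orthogonal to v, and cutting it with H_v, which misses the origin, lowers
-- its dimension by exactly one.
--
-- On the closed chamber write s_1 = |x_ω(1)| ≤ s_2 ≤ ⋯ ≤ s_n with s_k = ε_k x_ω(k). Abel
-- summation bounds v · x below by Σ_k τ_k (s_k - s_(k-1)), where τ_k = Σ_(j ≥ k) ±2^(ω(j) - 1)
-- has sign - exactly at the barred positions and at position 1 (as |x| ≥ -x). The sign of
-- τ_k is that of its largest term, which sits at a right-to-left maximum. If ω(1) ≠ n and all
-- right-to-left maxima are unbarred, every τ_k ≥ 1, so |x_i| ≤ s_n ≤ v · x = v · v on the
-- section, which is nonempty by scaling. Otherwise τ_p ≤ -1 at some right-to-left maximum p,
-- and the point with chain (0, …, 0, 1, …, 1) starting at p is a recession direction along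
-- which the section is unbounded.

open import Defs
open import Data.Nat using (ℕ; suc)
open import Data.Fin using (Fin; fromℕ)
import Data.Fin as F
open import Data.Bool using (Bool; false)
open import Data.Product using (_×_)
open import Data.Fin.Permutation using (Permutation′; _⟨$⟩ʳ_)
open import Relation.Binary.PropositionalEquality using (_≡_; _≢_)
open import Function.Bundles using (_⇔_)

open import Algebra.Bundles using (Ring)
import Algebra.Properties.Semiring.Sum as SemiringSum
open import Data.Bool using (true; if_then_else_)
open import Data.Empty using (⊥-elim)
import Data.Fin.Properties as FP
open import Data.Fin using (toℕ)
open import Data.Fin.Permutation using (_⟨$⟩ˡ_; inverseˡ; inverseʳ)
open import Data.List using (List)
import Data.List.Relation.Unary.All as All
open import Data.Nat as ℕ using (zero)
import Data.Nat.Properties as ℕP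
open import Data.Product using (∃; _,_; proj₁; proj₂)
import Data.Rational as ℚ
open import Data.Rational using (ℚ; 0ℚ; 1ℚ; _+_; _*_; -_; _-_; ∣_∣; _<_; _≤_; 1/_; NonZero; ≢-nonZero)
import Data.Rational.Properties as ℚP
open import Algebra.Properties.Group ℚP.+-0-group using () renaming (⁻¹-involutive to neg-involutive)
open import Data.Rational.Solver using (module +-*-Solver)
open +-*-Solver using (solve; _:+_; _:*_; :-_; _:-_; _:=_; con)
open import Data.Sum using (inj₁; inj₂)
open import Data.Vec.Functional using (_∷_)
open import Function.Bundles using (Injection; mk⇔)
open import Function.Properties.Inverse using (↔⇒↣)
import Function.Properties.Equivalence as ⇔
open import Relation.Binary.PropositionalEquality using (refl; sym; trans; cong; cong₂; subst; subst₂)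
open import Relation.Nullary using (¬_; Dec; yes; no; does)

open ℚP.≤-Reasoning

p≤q⇒0≤q-p : ∀ {p q} → p ≤ q → 0ℚ ≤ q - p
p≤q⇒0≤q-p {p} {q} h = subst (_≤ q - p) (ℚP.+-inverseʳ p) (ℚP.+-monoˡ-≤ (- p) h)

≤-by-difference : ∀ {p q} d → q - p ≡ d → 0ℚ ≤ d → p ≤ q
≤-by-difference {p} {q} d q-p≡d 0≤d =
  subst₂ _≤_ (ℚP.+-identityˡ p) (solve 2 (λ q p → (q :- p) :+ p := q) refl q p)
    (ℚP.+-monoˡ-≤ p (subst (0ℚ ≤_) (sym q-p≡d) 0≤d))

<-by-difference : ∀ {p q} d → q - p ≡ d → 0ℚ < d → p < q
<-by-difference {p} {q} d q-p≡d 0<d =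
  subst₂ _<_ (ℚP.+-identityˡ p) (solve 2 (λ q p → (q :- p) :+ p := q) refl q p)
    (ℚP.+-monoˡ-< p (subst (0ℚ <_) (sym q-p≡d) 0<d))

*-nonNeg : ∀ {p q} → 0ℚ ≤ p → 0ℚ ≤ q → 0ℚ ≤ p * q
*-nonNeg {p} {q} 0≤p 0≤q =
  ℚP.nonNegative⁻¹ (p * q) {{ℚP.nonNeg*nonNeg⇒nonNeg p {{ℚ.nonNegative 0≤p}} q {{ℚ.nonNegative 0≤q}}}}

*-pos : ∀ {p q} → 0ℚ < p → 0ℚ < q → 0ℚ < p * q
*-pos {p} {q} 0<p 0<q =
  ℚP.positive⁻¹ (p * q) {{ℚP.pos*pos⇒pos p {{ℚ.positive 0<p}} q {{ℚ.positive 0<q}}}}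

+-nonNeg : ∀ {p q} → 0ℚ ≤ p → 0ℚ ≤ q → 0ℚ ≤ p + q
+-nonNeg = ℚP.+-mono-≤

0≤1 : 0ℚ ≤ 1ℚ
0≤1 = ℚP.nonNegative⁻¹ 1ℚ

0<1 : 0ℚ < 1ℚ
0<1 = ℚP.positive⁻¹ 1ℚ

-∣p∣≤p : ∀ p → - ∣ p ∣ ≤ p
-∣p∣≤p p with ℚP.∣p∣≡p∨∣p∣≡-p p
... | inj₁ ∣p∣≡p  = ℚP.≤-trans (ℚP.neg-antimono-≤ (ℚP.0≤∣p∣ p))
                                (subst (0ℚ ≤_) ∣p∣≡p (ℚP.0≤∣p∣ p))
... | inj₂ ∣p∣≡-p = ℚP.≤-reflexive (trans (cong -_ ∣p∣≡-p) (neg-involutive p))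

p≤∣p∣ : ∀ p → p ≤ ∣ p ∣
p≤∣p∣ p = subst₂ _≤_ (neg-involutive p) (neg-involutive ∣ p ∣)
  (ℚP.neg-antimono-≤ (subst (λ q → - q ≤ - p) (ℚP.∣-p∣≡∣p∣ p) (-∣p∣≤p (- p))))

0≤p+∣p∣ : ∀ p → 0ℚ ≤ p + ∣ p ∣
0≤p+∣p∣ p = subst (0ℚ ≤_) (cong (p +_) (neg-involutive ∣ p ∣)) (p≤q⇒0≤q-p (-∣p∣≤p p))

p*q≡0⇒p≡0 : ∀ p q → q ≢ 0ℚ → p * q ≡ 0ℚ → p ≡ 0ℚ
p*q≡0⇒p≡0 p q q≢0 pq≡0 = begin-equality
  p               ≡⟨ sym (ℚP.*-identityʳ p) ⟩
  p * 1ℚ          ≡⟨ cong (p *_) (sym (ℚP.*-inverseʳ q)) ⟩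
  p * (q * 1/ q)  ≡⟨ sym (ℚP.*-assoc p q (1/ q)) ⟩
  (p * q) * 1/ q  ≡⟨ cong (_* 1/ q) pq≡0 ⟩
  0ℚ * 1/ q       ≡⟨ ℚP.*-zeroˡ (1/ q) ⟩
  0ℚ              ∎
  where instance _ = ≢-nonZero q≢0

p/q*q≡p : ∀ p q .{{_ : NonZero q}} → p * 1/ q * q ≡ p
p/q*q≡p p q = trans (ℚP.*-assoc p (1/ q) q) (trans (cong (p *_) (ℚP.*-inverseˡ q)) (ℚP.*-identityʳ p))

sign : Bool → ℚ
sign false = 1ℚ
sign true  = - 1ℚ

sign*sign : ∀ b → sign b * sign b ≡ 1ℚ
sign*sign false = refl
sign*sign true  = refl

sign*sign*p : ∀ b p → sign b * (sign b * p) ≡ p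
sign*sign*p b p = begin-equality
  sign b * (sign b * p)  ≡⟨ ℚP.*-assoc (sign b) (sign b) p ⟨
  sign b * sign b * p    ≡⟨ cong (_* p) (sign*sign b) ⟩
  1ℚ * p                 ≡⟨ ℚP.*-identityˡ p ⟩
  p                      ∎

∣sign*p∣≡∣p∣ : ∀ b p → ∣ sign b * p ∣ ≡ ∣ p ∣
∣sign*p∣≡∣p∣ false p = cong ∣_∣ (ℚP.*-identityˡ p)
∣sign*p∣≡∣p∣ true  p = trans (cong ∣_∣ (sym (ℚP.neg-distribˡ-* 1ℚ p)))
                          (trans (ℚP.∣-p∣≡∣p∣ (1ℚ * p)) (cong ∣_∣ (ℚP.*-identityˡ p)))

sign*p≤∣p∣ : ∀ b p → sign b * p ≤ ∣ p ∣
sign*p≤∣p∣ b p = subst (sign b * p ≤_) (∣sign*p∣≡∣p∣ b p) (p≤∣p∣ (sign b * p))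

if-neg≡sign* : ∀ b q → (if b then - q else q) ≡ sign b * q
if-neg≡sign* false q = sym (ℚP.*-identityˡ q)
if-neg≡sign* true  q = trans (cong -_ (sym (ℚP.*-identityˡ q))) (ℚP.neg-distribˡ-* 1ℚ q)

p≡sign*∣p∣ : ∀ p → ∃ λ b → p ≡ sign b * ∣ p ∣
p≡sign*∣p∣ p with ℚP.∣p∣≡p∨∣p∣≡-p p
... | inj₁ ∣p∣≡p  = false , sym (trans (ℚP.*-identityˡ ∣ p ∣) ∣p∣≡p)
... | inj₂ ∣p∣≡-p = true , sym (begin-equality
  - 1ℚ * ∣ p ∣      ≡⟨ cong (- 1ℚ *_) ∣p∣≡-p ⟩
  - 1ℚ * - p        ≡⟨ ℚP.neg-distribˡ-* 1ℚ (- p) ⟨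
  - (1ℚ * - p)      ≡⟨ cong -_ (ℚP.*-identityˡ (- p)) ⟩
  - - p             ≡⟨ neg-involutive p ⟩
  p                 ∎)

2ℚ : ℚ
2ℚ = 1ℚ + 1ℚ

0<pow2 : ∀ k → 0ℚ < pow2 k
0<pow2 zero    = 0<1
0<pow2 (suc k) = *-pos (ℚP.positive⁻¹ 2ℚ) (0<pow2 k)

0≤pow2 : ∀ k → 0ℚ ≤ pow2 k
0≤pow2 k = ℚP.<⇒≤ (0<pow2 k)

module ∑ = SemiringSum (Ring.semiring ℚP.+-*-ring)

sumF≡sum : ∀ {n} (f : Fin n → ℚ) → sumF f ≡ ∑.sum f
sumF≡sum {zero}  f = refl
sumF≡sum {suc n} f = cong (f F.zero +_) (sumF≡sum (λ i → f (F.suc i)))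

sumF-cong : ∀ {n} {f g : Fin n → ℚ} → (∀ i → f i ≡ g i) → sumF f ≡ sumF g
sumF-cong {f = f} {g} f≗g = trans (sumF≡sum f) (trans (∑.sum-cong-≗ f≗g) (sym (sumF≡sum g)))

sumF-zero : ∀ {n} {f : Fin n → ℚ} → (∀ i → f i ≡ 0ℚ) → sumF f ≡ 0ℚ
sumF-zero {n} f≗0 = trans (sumF-cong f≗0) (trans (sumF≡sum {n} (λ _ → 0ℚ)) (∑.sum-replicate-zero n))

sumF-distrib-+ : ∀ {n} (f g : Fin n → ℚ) → sumF (λ i → f i + g i) ≡ sumF f + sumF g
sumF-distrib-+ f g = trans (sumF≡sum (λ i → f i + g i)) (trans (∑.∑-distrib-+ f g)
  (sym (cong₂ _+_ (sumF≡sum f) (sumF≡sum g))))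

*-distribˡ-sumF : ∀ {n} c (f : Fin n → ℚ) → sumF (λ i → c * f i) ≡ c * sumF f
*-distribˡ-sumF c f = trans (sumF≡sum (λ i → c * f i)) (trans (sym (∑.*-distribˡ-sum c f))
  (cong (c *_) (sym (sumF≡sum f))))

*-distribʳ-sumF : ∀ {n} c (f : Fin n → ℚ) → sumF (λ i → f i * c) ≡ sumF f * c
*-distribʳ-sumF c f = trans (sumF≡sum (λ i → f i * c)) (trans (sym (∑.*-distribʳ-sum c f))
  (cong (_* c) (sym (sumF≡sum f))))

sumF-comm : ∀ {m n} (f : Fin m → Fin n → ℚ) →
            sumF (λ i → sumF (λ j → f i j)) ≡ sumF (λ j → sumF (λ i → f i j))
sumF-comm f = begin-equality
  sumF (λ i → sumF (f i))            ≡⟨ sumF-cong (λ i → sumF≡sum (f i)) ⟩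
  sumF (λ i → ∑.sum (f i))           ≡⟨ sumF≡sum (λ i → ∑.sum (f i)) ⟩
  ∑.sum (λ i → ∑.sum (f i))          ≡⟨ ∑.∑-comm f ⟩
  ∑.sum (λ j → ∑.sum (λ i → f i j))  ≡⟨ sumF≡sum (λ j → ∑.sum (λ i → f i j)) ⟨
  sumF (λ j → ∑.sum (λ i → f i j))   ≡⟨ sumF-cong (λ j → sumF≡sum (λ i → f i j)) ⟨
  sumF (λ j → sumF (λ i → f i j))    ∎

sumF-permute : ∀ {n} (f : Fin n → ℚ) (ω : Permutation′ n) → sumF f ≡ sumF (λ k → f (ω ⟨$⟩ʳ k))
sumF-permute f ω = trans (sumF≡sum f) (trans (∑.sum-permute f ω) (sym (sumF≡sum (λ k → f (ω ⟨$⟩ʳ k)))))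

sumF-mono-≤ : ∀ {n} {f g : Fin n → ℚ} → (∀ i → f i ≤ g i) → sumF f ≤ sumF g
sumF-mono-≤ {zero}  f≤g = ℚP.≤-refl
sumF-mono-≤ {suc n} f≤g = ℚP.+-mono-≤ (f≤g F.zero) (sumF-mono-≤ (λ i → f≤g (F.suc i)))

sumF-nonNeg : ∀ {n} {f : Fin n → ℚ} → (∀ i → 0ℚ ≤ f i) → 0ℚ ≤ sumF f
sumF-nonNeg {n} {f} 0≤f = subst (_≤ sumF f) (sumF-zero {n} (λ _ → refl)) (sumF-mono-≤ 0≤f)

0ᵥ : ∀ {n} → Point n
0ᵥ _ = 0ℚ

infixl 6 _+ᵥ_
infixr 7 _•_

_+ᵥ_ : ∀ {n} → Point n → Point n → Point n
(x +ᵥ y) i = x i + y i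

_•_ : ∀ {n} → ℚ → Point n → Point n
(l • x) i = l * x i

combination : ∀ {m n} → (Fin m → ℚ) → (Fin m → Point n) → Point n
combination c p i = sumF (λ k → c k * p k i)

·-distrib-+ᵥ : ∀ {n} (v x y : Point n) → v · (x +ᵥ y) ≡ v · x + v · y
·-distrib-+ᵥ v x y = trans (sumF-cong (λ i → ℚP.*-distribˡ-+ (v i) (x i) (y i)))
  (sumF-distrib-+ (λ i → v i * x i) (λ i → v i * y i))

·-• : ∀ {n} (v : Point n) l x → v · (l • x) ≡ l * (v · x)
·-• v l x = trans (sumF-cong (λ i → solve 3 (λ v l x → v :* (l :* x) := l :* (v :* x)) refl (v i) l (x i)))
  (*-distribˡ-sumF l (λ i → v i * x i))

·-combination : ∀ {m n} (v : Point n) (c : Fin m → ℚ) (p : Fin m → Point n) →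
                v · combination c p ≡ sumF (λ k → c k * (v · p k))
·-combination v c p = begin-equality
  sumF (λ i → v i * sumF (λ k → c k * p k i))
    ≡⟨ sumF-cong (λ i → sym (*-distribˡ-sumF (v i) (λ k → c k * p k i))) ⟩
  sumF (λ i → sumF (λ k → v i * (c k * p k i))) ≡⟨ sumF-comm (λ i k → v i * (c k * p k i)) ⟩
  sumF (λ k → sumF (λ i → v i * (c k * p k i))) ≡⟨ sumF-cong (λ k → ·-• v (c k) (p k)) ⟩
  sumF (λ k → c k * (v · p k))                  ∎

·-permute : ∀ {n} (x y : Point n) (ω : Permutation′ n) →
            x · y ≡ sumF (λ k → x (ω ⟨$⟩ʳ k) * y (ω ⟨$⟩ʳ k))
·-permute x y = sumF-permute (λ i → x i * y i)

∃-largest : ∀ {n} {P : Fin n → Set} → (∀ i → Dec (P i)) → ∀ {i} → P i →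
            ∃ λ p → P p × (∀ j → P j → j F.≤ p)
∃-largest {suc n} P? {i} Pi with FP.any? (λ j → P? (F.suc j))
... | yes (j , Psj) with ∃-largest (λ j → P? (F.suc j)) Psj
...   | p , Psp , largest = F.suc p , Psp , λ where
          F.zero    _   → ℕ.z≤n
          (F.suc j) Psj → ℕ.s≤s (largest j Psj)
∃-largest {suc n} P? {F.zero}  P0  | no ¬Ptail = F.zero , P0 , λ where
          F.zero    _   → ℕ.z≤n
          (F.suc j) Psj → ⊥-elim (¬Ptail (j , Psj))
∃-largest {suc n} P? {F.suc i} Psi | no ¬Ptail = ⊥-elim (¬Ptail (i , Psi))

vvec·-suc : ∀ {n} (c : Point (suc n)) →
            vvec (suc n) · c ≡ c F.zero + 2ℚ * (vvec n · (λ j → c (F.suc j)))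
vvec·-suc c = cong₂ _+_ (ℚP.*-identityˡ (c F.zero))
  (trans (sumF-cong (λ j → ℚP.*-assoc 2ℚ (pow2 (toℕ j)) (c (F.suc j))))
         (*-distribˡ-sumF 2ℚ (λ j → pow2 (toℕ j) * c (F.suc j))))

-- The weights below the top index i sum to 2^i - 1, so the top term 2^i T outweighs the rest.
top-coefficient-dominates : ∀ {n} (c : Point n) {T} i → (∀ j → ∣ c j ∣ ≤ T) → c i ≡ T →
                            (∀ j → i F.< j → c j ≡ 0ℚ) → T ≤ vvec n · c
top-coefficient-dominates {suc n} c {T} F.zero bound c0≡T above = ℚP.≤-reflexive (sym (begin-equality
  vvec (suc n) · c                          ≡⟨ vvec·-suc c ⟩
  c F.zero + 2ℚ * (vvec n · λ j → c (F.suc j)) ≡⟨ cong₂ (λ a g → a + 2ℚ * g) c0≡T (sumF-zero vanish) ⟩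
  T + 2ℚ * 0ℚ                               ≡⟨ ℚP.+-identityʳ T ⟩
  T                                         ∎))
  where
  vanish : ∀ j → pow2 (toℕ j) * c (F.suc j) ≡ 0ℚ
  vanish j = trans (cong (pow2 (toℕ j) *_) (above (F.suc j) (ℕ.s≤s ℕ.z≤n))) (ℚP.*-zeroʳ (pow2 (toℕ j)))
top-coefficient-dominates {suc n} c {T} (F.suc i) bound ci≡T above =
  subst (T ≤_) (sym (vvec·-suc c)) (≤-by-difference ((c F.zero + T) + 2ℚ * (g - T))
    (solve 3 (λ c₀ g T → (c₀ :+ con 2ℚ :* g) :- T := (c₀ :+ T) :+ con 2ℚ :* (g :- T)) refl (c F.zero) g T)
    (+-nonNeg 0≤c₀+T (*-nonNeg (+-nonNeg 0≤1 0≤1) (p≤q⇒0≤q-p T≤g))))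
  where
  g = vvec n · (λ j → c (F.suc j))
  T≤g : T ≤ g
  T≤g = top-coefficient-dominates (λ j → c (F.suc j)) i (λ j → bound (F.suc j)) ci≡T
          (λ j i<j → above (F.suc j) (ℕ.s≤s i<j))
  0≤c₀+T : 0ℚ ≤ c F.zero + T
  0≤c₀+T = subst (0ℚ ≤_) (cong (c F.zero +_) (neg-involutive T))
    (p≤q⇒0≤q-p (ℚP.≤-trans (ℚP.neg-antimono-≤ (bound F.zero)) (-∣p∣≤p (c F.zero))))

top-coefficient-dominates± : ∀ {n} (c : Point n) {T} i b → (∀ j → ∣ c j ∣ ≤ T) →
                             c i ≡ sign b * T → (∀ j → i F.< j → c j ≡ 0ℚ) →
                             T ≤ sign b * (vvec n · c)
top-coefficient-dominates± {n} c {T} i b bound ci≡±T above =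
  subst (T ≤_) (·-• (vvec n) (sign b) c) (top-coefficient-dominates (sign b • c) i
    (λ j → subst (_≤ T) (sym (∣sign*p∣≡∣p∣ b (c j))) (bound j))
    (trans (cong (sign b *_) ci≡±T) (sign*sign*p b T))
    (λ j i<j → trans (cong (sign b *_) (above j i<j)) (ℚP.*-zeroʳ (sign b))))

1≤vvec·vvec : ∀ n → 1ℚ ≤ vvec (suc n) · vvec (suc n)
1≤vvec·vvec n = ≤-by-difference (sumF tail)
  (solve 1 (λ s → (con 1ℚ :+ s) :- con 1ℚ := s) refl (sumF tail))
  (sumF-nonNeg {f = tail} (λ i → *-nonNeg (0≤pow2 (suc (toℕ i))) (0≤pow2 (suc (toℕ i)))))
  where
  tail : Fin n → ℚ
  tail i = pow2 (suc (toℕ i)) * pow2 (suc (toℕ i))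

-- Genericity

record IsSubspace {n} (X : Point n → Set) : Set where
  field
    0ᵥ∈      : X 0ᵥ
    +ᵥ-closed : ∀ {x y} → X x → X y → X (x +ᵥ y)
    •-closed  : ∀ l {x} → X x → X (l • x)

Odd : (ℚ → ℚ) → Set
Odd f = ∀ q → f (- q) ≡ - f q

onDHyp-map : ∀ {n} (f : ℚ → ℚ) → Odd f → ∀ h {x : Point n} → onDHyp h x → onDHyp h (λ i → f (x i))
onDHyp-map f odd (dhyp i j _ false) xi≡xj  = cong f xi≡xj
onDHyp-map f odd (dhyp i j _ true) {x} xi≡-xj = trans (cong f xi≡-xj) (odd (x j))

inter-map : ∀ {n} (fam : List (DHyp n)) (f : ℚ → ℚ) → Odd f →
            ∀ {x} → Inter fam x → Inter fam (λ i → f (x i))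
inter-map fam f odd {x} = All.map (λ {h} → onDHyp-map f odd h {x})

onDHyp-+ᵥ : ∀ {n} h {x y : Point n} → onDHyp h x → onDHyp h y → onDHyp h (x +ᵥ y)
onDHyp-+ᵥ (dhyp i j _ false) xi≡xj yi≡yj = cong₂ _+_ xi≡xj yi≡yj
onDHyp-+ᵥ (dhyp i j _ true) {x} {y} xi≡-xj yi≡-yj =
  trans (cong₂ _+_ xi≡-xj yi≡-yj) (sym (ℚP.neg-distrib-+ (x j) (y j)))

onDHyp-0ᵥ : ∀ {n} h → onDHyp {n} h 0ᵥ
onDHyp-0ᵥ (dhyp i j _ false) = refl
onDHyp-0ᵥ (dhyp i j _ true)  = refl

inter-isSubspace : ∀ {n} (fam : List (DHyp n)) → IsSubspace (Inter fam)
inter-isSubspace fam = record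
  { 0ᵥ∈      = All.universal onDHyp-0ᵥ fam
  ; +ᵥ-closed = λ {x} {y} x∈ y∈ → All.zipWith (λ {h} (hx , hy) → onDHyp-+ᵥ h {x} {y} hx hy) (x∈ , y∈)
  ; •-closed  = λ l → inter-map fam (l *_) (λ q → sym (ℚP.neg-distribʳ-* l q))
  }

·-zero : ∀ {n} (v x : Point n) → (∀ i → x i ≡ 0ℚ) → v · x ≡ 0ℚ
·-zero v x x≗0 = sumF-zero (λ i → trans (cong (v i *_) (x≗0 i)) (ℚP.*-zeroʳ (v i)))

LinIndep : ∀ {m n} → (Fin m → Point n) → Set
LinIndep p = ∀ c → (∀ i → combination c p i ≡ 0ℚ) → ∀ k → c k ≡ 0ℚ

linIndep⇒affIndep : ∀ {m n} {p : Fin m → Point n} → LinIndep p → AffIndep p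
linIndep⇒affIndep indep c _ = indep c

linIndep-• : ∀ {m n} {p : Fin m → Point n} (κ : Fin m → ℚ) → (∀ k → κ k ≢ 0ℚ) →
             LinIndep p → LinIndep (λ k → κ k • p k)
linIndep-• {p = p} κ κ≢0 indep c comb≡0 k = p*q≡0⇒p≡0 (c k) (κ k) (κ≢0 k)
  (indep (λ k → c k * κ k) (λ i → trans (sumF-cong (λ k → ℚP.*-assoc (c k) (κ k) (p k i))) (comb≡0 i)) k)

linIndep⇒nonzero : ∀ {m n} {u : Fin (suc m) → Point n} → LinIndep u → ∃ λ i → u F.zero i ≢ 0ℚ
linIndep⇒nonzero {n = n} {u} indep = FP.¬∀⟶∃¬ n _ (λ i → u F.zero i ℚP.≟ 0ℚ) λ u₀≡0 →
  1≢0 (indep (1ℚ ∷ λ _ → 0ℚ) (λ i → cong₂ _+_ (trans (ℚP.*-identityˡ _) (u₀≡0 i))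
                                           (sumF-zero (λ k → ℚP.*-zeroˡ (u (F.suc k) i)))) F.zero)
  where
  1≢0 : 1ℚ ≢ 0ℚ
  1≢0 ()

affIndep⇒linIndep-differences : ∀ {m n} (p : Fin (suc m) → Point n) → AffIndep p →
                                LinIndep (λ k → p (F.suc k) +ᵥ (- 1ℚ) • p F.zero)
affIndep⇒linIndep-differences p indep c comb≡0 k =
  indep ((- sumF c) ∷ c) (ℚP.+-inverseˡ (sumF c)) (λ i → trans (sym (rearrange i)) (comb≡0 i)) (F.suc k)
  where
  p′ = λ k → p (F.suc k)
  rearrange : ∀ i → combination c (λ k → p′ k +ᵥ (- 1ℚ) • p F.zero) i
                  ≡ - sumF c * p F.zero i + combination c p′ i
  rearrange i = begin-equality
    combination c (λ k → p′ k +ᵥ (- 1ℚ) • p F.zero) i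
      ≡⟨ sumF-cong (λ k → solve 3 (λ c a b → c :* (a :+ con (- 1ℚ) :* b) := c :* a :+ c :* (:- b))
                                  refl (c k) (p′ k i) (p F.zero i)) ⟩
    sumF (λ k → c k * p′ k i + c k * - p F.zero i)
      ≡⟨ sumF-distrib-+ (λ k → c k * p′ k i) (λ k → c k * - p F.zero i) ⟩
    combination c p′ i + sumF (λ k → c k * - p F.zero i)
      ≡⟨ cong (combination c p′ i +_) (*-distribʳ-sumF (- p F.zero i) c) ⟩
    combination c p′ i + sumF c * - p F.zero i
      ≡⟨ solve 3 (λ A S b → A :+ S :* (:- b) := (:- S) :* b :+ A)
                 refl (combination c p′ i) (sumF c) (p F.zero i) ⟩
    - sumF c * p F.zero i + combination c p′ i
      ∎

adjoin-origin : ∀ {m n} (v : Point n) {X : Point n → Set} → v · v ≢ 0ℚ → X 0ᵥ →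
               HasAffIndep (H v ∩ X) m → HasAffIndep X (suc m)
adjoin-origin v {X} vv≢0 0∈X (q , q∈ , indep) = (0ᵥ ∷ q) , ∈X , indep′
  where
  ∈X : ∀ k → X ((0ᵥ ∷ q) k)
  ∈X F.zero    = 0∈X
  ∈X (F.suc k) = proj₂ (q∈ k)
  indep′ : AffIndep (0ᵥ ∷ q)
  indep′ c Σc≡0 comb≡0 = c≡0
    where
    c′ = λ k → c (F.suc k)
    comb′≡0 : ∀ i → combination c′ q i ≡ 0ℚ
    comb′≡0 i = trans (sym (trans (cong (_+ combination c′ q i) (ℚP.*-zeroʳ (c F.zero)))
                                  (ℚP.+-identityˡ _))) (comb≡0 i)
    Σc′≡0 : sumF c′ ≡ 0ℚ
    Σc′≡0 = p*q≡0⇒p≡0 (sumF c′) (v · v) vv≢0 (begin-equality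
      sumF c′ * (v · v)              ≡⟨ *-distribʳ-sumF (v · v) c′ ⟨
      sumF (λ k → c′ k * (v · v))    ≡⟨ sumF-cong (λ k → cong (c′ k *_) (sym (proj₁ (q∈ k)))) ⟩
      sumF (λ k → c′ k * (v · q k))  ≡⟨ ·-combination v c′ q ⟨
      v · combination c′ q           ≡⟨ ·-zero v _ comb′≡0 ⟩
      0ℚ                             ∎)
    c≡0 : ∀ k → c k ≡ 0ℚ
    c≡0 F.zero    = trans (sym (trans (cong (c F.zero +_) Σc′≡0) (ℚP.+-identityʳ _))) Σc≡0
    c≡0 (F.suc k) = indep c′ Σc′≡0 comb′≡0 k

combination-shear : ∀ {m n} (c θ : Fin m → ℚ) (u : Fin m → Point n) (g : Point n) i →
                    combination c (λ k → u k +ᵥ θ k • g) i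
                    ≡ combination c u i + sumF (λ k → c k * θ k) * g i
combination-shear c θ u g i = begin-equality
  sumF (λ k → c k * (u k i + θ k * g i))
    ≡⟨ sumF-cong (λ k → solve 4 (λ c a t b → c :* (a :+ t :* b) := c :* a :+ (c :* t) :* b)
                                refl (c k) (u k i) (θ k) (g i)) ⟩
  sumF (λ k → c k * u k i + (c k * θ k) * g i)
    ≡⟨ sumF-distrib-+ (λ k → c k * u k i) (λ k → (c k * θ k) * g i) ⟩
  combination c u i + sumF (λ k → (c k * θ k) * g i)
    ≡⟨ cong (combination c u i +_) (*-distribʳ-sumF (g i) (λ k → c k * θ k)) ⟩
  combination c u i + sumF (λ k → c k * θ k) * g i
    ∎

δ : ∀ {m} → Fin m → Fin m → ℚ
δ J k = if does (J FP.≟ k) then 1ℚ else 0ℚ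

δ-≢ : ∀ {m} {J k : Fin m} → J ≢ k → δ J k ≡ 0ℚ
δ-≢ {J = J} {k} J≢k with J FP.≟ k
... | yes J≡k = ⊥-elim (J≢k J≡k)
... | no  _   = refl

sumF-δ : ∀ {m} (J : Fin m) (g : Fin m → ℚ) → sumF (λ k → δ J k * g k) ≡ g J
sumF-δ {suc m} F.zero g = trans (cong (1ℚ * g F.zero +_) (sumF-zero (λ k → ℚP.*-zeroˡ (g (F.suc k)))))
  (trans (ℚP.+-identityʳ _) (ℚP.*-identityˡ _))
sumF-δ {suc m} (F.suc J) g = trans (cong (_+ sumF (λ k → δ J k * g (F.suc k))) (ℚP.*-zeroˡ (g F.zero)))
  (trans (ℚP.+-identityˡ _) (sumF-δ J (λ k → g (F.suc k))))

-- Shearing every vector along one of them is undone by moving the shear into the coefficient of u J.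
linIndep-shear : ∀ {m n} (u : Fin m → Point n) (θ : Fin m → ℚ) J → θ J ≡ 0ℚ →
                 LinIndep u → LinIndep (λ k → u k +ᵥ θ k • u J)
linIndep-shear u θ J θJ≡0 indep c comb≡0 = c≡0
  where
  Θ = sumF (λ k → c k * θ k)
  C′ = λ k → c k + Θ * δ J k
  C′≡0 : ∀ k → C′ k ≡ 0ℚ
  C′≡0 = indep C′ λ i → begin-equality
    sumF (λ k → (c k + Θ * δ J k) * u k i)
      ≡⟨ sumF-cong (λ k → solve 4 (λ c t d a → (c :+ t :* d) :* a := c :* a :+ t :* (d :* a))
                                  refl (c k) Θ (δ J k) (u k i)) ⟩
    sumF (λ k → c k * u k i + Θ * (δ J k * u k i))
      ≡⟨ sumF-distrib-+ (λ k → c k * u k i) (λ k → Θ * (δ J k * u k i)) ⟩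
    combination c u i + sumF (λ k → Θ * (δ J k * u k i))
      ≡⟨ cong (combination c u i +_) (trans (*-distribˡ-sumF Θ (λ k → δ J k * u k i))
                                            (cong (Θ *_) (sumF-δ J (λ k → u k i)))) ⟩
    combination c u i + Θ * u J i
      ≡⟨ combination-shear c θ u (u J) i ⟨
    combination c (λ k → u k +ᵥ θ k • u J) i
      ≡⟨ comb≡0 i ⟩
    0ℚ ∎
  c-off : ∀ {k} → J ≢ k → c k ≡ 0ℚ
  c-off {k} J≢k = begin-equality
    c k                ≡⟨ ℚP.+-identityʳ (c k) ⟨
    c k + 0ℚ           ≡⟨ cong (c k +_) (ℚP.*-zeroʳ Θ) ⟨
    c k + Θ * 0ℚ       ≡⟨ cong (λ d → c k + Θ * d) (δ-≢ J≢k) ⟨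
    c k + Θ * δ J k    ≡⟨ C′≡0 k ⟩
    0ℚ                 ∎
  cθ≡0 : ∀ k → c k * θ k ≡ 0ℚ
  cθ≡0 k with J FP.≟ k
  ... | yes refl = trans (cong (c J *_) θJ≡0) (ℚP.*-zeroʳ (c J))
  ... | no  J≢k  = trans (cong (_* θ k) (c-off J≢k)) (ℚP.*-zeroˡ (θ k))
  Θ≡0 : Θ ≡ 0ℚ
  Θ≡0 = sumF-zero cθ≡0
  c≡0 : ∀ k → c k ≡ 0ℚ
  c≡0 k = trans (sym (trans (cong (λ t → c k + t * δ J k) Θ≡0)
                     (trans (cong (c k +_) (ℚP.*-zeroˡ (δ J k))) (ℚP.+-identityʳ (c k))))) (C′≡0 k)

-- When v vanishes on every u k but not on w, w lies outside their span.
linIndep-translate : ∀ {m n} (v : Point n) (u : Fin m → Point n) w → (∀ k → v · u k ≡ 0ℚ) →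
                     v · w ≢ 0ℚ → LinIndep u → LinIndep (λ k → u k +ᵥ 1ℚ • w)
linIndep-translate v u w vu≡0 vw≢0 indep c comb≡0 = indep c comb-u≡0
  where
  Θ = sumF (λ k → c k * 1ℚ)
  Θ≡0 : Θ ≡ 0ℚ
  Θ≡0 = p*q≡0⇒p≡0 Θ (v · w) vw≢0 (begin-equality
    Θ * (v · w)                                        ≡⟨ ℚP.+-identityˡ _ ⟨
    0ℚ + Θ * (v · w)                                   ≡⟨ cong (_+ Θ * (v · w)) vcu≡0 ⟨
    v · combination c u + Θ * (v · w)                  ≡⟨ cong (v · combination c u +_) (·-• v Θ w) ⟨
    v · combination c u + v · (Θ • w)                  ≡⟨ ·-distrib-+ᵥ v (combination c u) (Θ • w) ⟨
    v · (combination c u +ᵥ Θ • w)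
      ≡⟨ sumF-cong (λ i → cong (v i *_) (combination-shear c (λ _ → 1ℚ) u w i)) ⟨
    v · combination c (λ k → u k +ᵥ 1ℚ • w)            ≡⟨ ·-zero v _ comb≡0 ⟩
    0ℚ                                                 ∎)
    where
    vcu≡0 : v · combination c u ≡ 0ℚ
    vcu≡0 = trans (·-combination v c u) (sumF-zero (λ k → trans (cong (c k *_) (vu≡0 k)) (ℚP.*-zeroʳ (c k))))
  comb-u≡0 : ∀ i → combination c u i ≡ 0ℚ
  comb-u≡0 i = begin-equality
    combination c u i                                  ≡⟨ ℚP.+-identityʳ _ ⟨
    combination c u i + 0ℚ                             ≡⟨ cong (combination c u i +_) (ℚP.*-zeroˡ (w i)) ⟨
    combination c u i + 0ℚ * w i                       ≡⟨ cong (λ t → combination c u i + t * w i) Θ≡0 ⟨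
    combination c u i + Θ * w i                        ≡⟨ combination-shear c (λ _ → 1ℚ) u w i ⟨
    combination c (λ k → u k +ᵥ 1ℚ • w) i              ≡⟨ comb≡0 i ⟩
    0ℚ                                                 ∎

shift-nonzero : ∀ a b → b ≢ 0ℚ → a + (if does (a ℚP.≟ 0ℚ) then 1ℚ else 0ℚ) * b ≢ 0ℚ
shift-nonzero a b b≢0 with a ℚP.≟ 0ℚ
... | yes refl = λ b′≡0 → b≢0 (trans (sym (trans (ℚP.+-identityˡ _) (ℚP.*-identityˡ b))) b′≡0)
... | no  a≢0  = λ a′≡0 → a≢0 (trans (sym (trans (cong (a +_) (ℚP.*-zeroˡ b)) (ℚP.+-identityʳ a))) a′≡0)

transversal-basis : ∀ {m n} (v : Point n) {X : Point n → Set} → IsSubspace X →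
                    ∀ {w} → X w → v · w ≢ 0ℚ →
                    (u : Fin m → Point n) → (∀ k → X (u k)) → LinIndep u →
                    ∃ λ (f : Fin m → Point n) → (∀ k → X (f k)) × LinIndep f × (∀ k → v · f k ≢ 0ℚ)
transversal-basis {m} v X-sub {w} w∈ vw≢0 u u∈ indep with FP.all? (λ k → v · u k ℚP.≟ 0ℚ)
... | yes vu≡0 = (λ k → u k +ᵥ 1ℚ • w) , (λ k → +ᵥ-closed (u∈ k) (•-closed 1ℚ w∈))
               , linIndep-translate v u w vu≡0 vw≢0 indep , vf≢0
  where
  open IsSubspace X-sub
  vf≢0 : ∀ k → v · (u k +ᵥ 1ℚ • w) ≢ 0ℚ
  vf≢0 k vf≡0 = vw≢0 (begin-equality
    v · w                       ≡⟨ trans (ℚP.+-identityˡ _) (ℚP.*-identityˡ _) ⟨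
    0ℚ + 1ℚ * (v · w)           ≡⟨ cong (λ a → a + 1ℚ * (v · w)) (vu≡0 k) ⟨
    v · u k + 1ℚ * (v · w)      ≡⟨ cong (v · u k +_) (·-• v 1ℚ w) ⟨
    v · u k + v · (1ℚ • w)      ≡⟨ ·-distrib-+ᵥ v (u k) (1ℚ • w) ⟨
    v · (u k +ᵥ 1ℚ • w)         ≡⟨ vf≡0 ⟩
    0ℚ                          ∎)
... | no ¬vu≡0 with FP.¬∀⟶∃¬ m _ (λ k → v · u k ℚP.≟ 0ℚ) ¬vu≡0
...   | J , vuJ≢0 = (λ k → u k +ᵥ θ k • u J) , (λ k → +ᵥ-closed (u∈ k) (•-closed (θ k) (u∈ J)))
                  , linIndep-shear u θ J θJ≡0 indep , vf≢0
  where
  open IsSubspace X-sub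
  θ : Fin m → ℚ
  θ k = if does (v · u k ℚP.≟ 0ℚ) then 1ℚ else 0ℚ
  θJ≡0 : θ J ≡ 0ℚ
  θJ≡0 with v · u J ℚP.≟ 0ℚ
  ... | yes vuJ≡0 = ⊥-elim (vuJ≢0 vuJ≡0)
  ... | no  _     = refl
  vf≡ : ∀ k → v · (u k +ᵥ θ k • u J) ≡ v · u k + θ k * (v · u J)
  vf≡ k = trans (·-distrib-+ᵥ v (u k) (θ k • u J)) (cong (v · u k +_) (·-• v (θ k) (u J)))
  vf≢0 : ∀ k → v · (u k +ᵥ θ k • u J) ≢ 0ℚ
  vf≢0 k vf≡0 = shift-nonzero (v · u k) (v · u J) vuJ≢0 (trans (sym (vf≡ k)) vf≡0)

scale-onto-H : ∀ {m n} (v : Point n) {X : Point n → Set} → IsSubspace X → v · v ≢ 0ℚ →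
               (f : Fin m → Point n) → (∀ k → X (f k)) → LinIndep f → (∀ k → v · f k ≢ 0ℚ) →
               HasAffIndep (H v ∩ X) m
scale-onto-H {m} v X-sub vv≢0 f f∈ indep vf≢0 =
  (λ k → κ k • f k) , (λ k → on-H k , •-closed (κ k) (f∈ k)) , linIndep⇒affIndep (linIndep-• κ κ≢0 indep)
  where
  open IsSubspace X-sub
  κ : Fin m → ℚ
  κ k = (v · v) * 1/ (v · f k)
    where instance _ = ≢-nonZero (vf≢0 k)
  κvf≡vv : ∀ k → κ k * (v · f k) ≡ v · v
  κvf≡vv k = p/q*q≡p (v · v) (v · f k)
    where instance _ = ≢-nonZero (vf≢0 k)
  on-H : ∀ k → H v (κ k • f k)
  on-H k = trans (·-• v (κ k) (f k)) (κvf≡vv k)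
  κ≢0 : ∀ k → κ k ≢ 0ℚ
  κ≢0 k κ≡0 = vv≢0 (trans (sym (κvf≡vv k)) (trans (cong (_* (v · f k)) κ≡0) (ℚP.*-zeroˡ (v · f k))))

section-hasAffIndep : ∀ {m n} (v : Point n) {X : Point n → Set} → IsSubspace X → v · v ≢ 0ℚ →
                    (∃ λ w → X w × v · w ≢ 0ℚ) → HasAffIndep X (suc m) → HasAffIndep (H v ∩ X) m
section-hasAffIndep v X-sub vv≢0 (w , w∈ , vw≢0) (p , p∈ , indep) =
  let f , f∈ , f-indep , vf≢0 =
        transversal-basis v X-sub w∈ vw≢0 u u∈ (affIndep⇒linIndep-differences p indep)
  in  scale-onto-H v X-sub vv≢0 f f∈ f-indep vf≢0
  where
  open IsSubspace X-sub
  u = λ k → p (F.suc k) +ᵥ (- 1ℚ) • p F.zero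
  u∈ = λ k → +ᵥ-closed (p∈ (F.suc k)) (•-closed (- 1ℚ) (p∈ F.zero))

generic-if-transversal : ∀ {n} (v : Point n) → v · v ≢ 0ℚ →
  (∀ fam u i → Inter fam u → u i ≢ 0ℚ → ∃ λ w → Inter fam w × v · w ≢ 0ℚ) → GenericDn n (H v)
generic-if-transversal v vv≢0 transversal fam d (has , ¬more) =
  section d has , λ more → ¬more (adjoin-origin v {Inter fam} vv≢0 0ᵥ∈ more)
  where
  open IsSubspace (inter-isSubspace fam)
  section : ∀ d → HasAffIndep (Inter fam) (suc d) → HasAffIndep (H v ∩ Inter fam) d
  section zero    _                   = (λ ()) , (λ ()) , (λ _ _ _ ())
  section (suc d) pts@(p , p∈ , indep) =
    let u₀ = p (F.suc F.zero) +ᵥ (- 1ℚ) • p F.zero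
        i , u₀i≢0 = linIndep⇒nonzero {u = λ k → p (F.suc k) +ᵥ (- 1ℚ) • p F.zero}
                      (affIndep⇒linIndep-differences p indep)
    in  section-hasAffIndep v (inter-isSubspace fam) vv≢0
          (transversal fam u₀ i (+ᵥ-closed (p∈ (F.suc F.zero)) (•-closed (- 1ℚ) (p∈ F.zero))) u₀i≢0) pts

levelPart : ℚ → ℚ → ℚ
levelPart t q = if does (∣ q ∣ ℚP.≟ t) then q else 0ℚ

levelPart-odd : ∀ t → Odd (levelPart t)
levelPart-odd t q rewrite ℚP.∣-p∣≡∣p∣ q with ∣ q ∣ ℚP.≟ t
... | yes _ = refl
... | no  _ = refl

levelPart-on : ∀ {t q} → ∣ q ∣ ≡ t → levelPart t q ≡ q
levelPart-on {t} {q} ∣q∣≡t with ∣ q ∣ ℚP.≟ t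
... | yes _     = refl
... | no  ∣q∣≢t = ⊥-elim (∣q∣≢t ∣q∣≡t)

levelPart-off : ∀ {t q} → ∣ q ∣ ≢ t → levelPart t q ≡ 0ℚ
levelPart-off {t} {q} ∣q∣≢t with ∣ q ∣ ℚP.≟ t
... | yes ∣q∣≡t = ⊥-elim (∣q∣≢t ∣q∣≡t)
... | no  _     = refl

∣levelPart∣≤ : ∀ {t} q → 0ℚ ≤ t → ∣ levelPart t q ∣ ≤ t
∣levelPart∣≤ {t} q 0≤t with ∣ q ∣ ℚP.≟ t
... | yes ∣q∣≡t = ℚP.≤-reflexive ∣q∣≡t
... | no  _     = 0≤t

vvec-transversal : ∀ {n} (fam : List (DHyp n)) u i → Inter fam u → u i ≢ 0ℚ →
                   ∃ λ w → Inter fam w × vvec n · w ≢ 0ℚ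
vvec-transversal {n} fam u i u∈ ui≢0 = w , inter-map fam (levelPart t) (levelPart-odd t) u∈ , vw≢0
  where
  t = ∣ u i ∣
  w : Point n
  w j = levelPart t (u j)
  vw≢0 : vvec n · w ≢ 0ℚ
  vw≢0 vw≡0 with ∃-largest (λ j → ∣ u j ∣ ℚP.≟ t) {i} refl
  ... | top , ∣utop∣≡t , largest with p≡sign*∣p∣ (u top)
  ...   | b , utop≡±∣utop∣ = ui≢0 (ℚP.∣p∣≡0⇒p≡0 (u i) (ℚP.≤-antisym t≤0 (ℚP.0≤∣p∣ (u i))))
    where
    t≤0 : t ≤ 0ℚ
    t≤0 = subst (t ≤_) (trans (cong (sign b *_) vw≡0) (ℚP.*-zeroʳ (sign b)))
      (top-coefficient-dominates± w top b (λ j → ∣levelPart∣≤ (u j) (ℚP.0≤∣p∣ (u i)))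
        (trans (levelPart-on ∣utop∣≡t) (trans utop≡±∣utop∣ (cong (sign b *_) ∣utop∣≡t)))
        (λ j top<j → levelPart-off (λ ∣uj∣≡t → ℕP.<⇒≱ top<j (largest j ∣uj∣≡t))))

vvec-generic : ∀ n → GenericDn (suc n) (H (vvec (suc n)))
vvec-generic n = generic-if-transversal (vvec (suc n)) vv≢0 vvec-transversal
  where
  vv≢0 : vvec (suc n) · vvec (suc n) ≢ 0ℚ
  vv≢0 vv≡0 = ℚP.<-irrefl refl (ℚP.<-≤-trans 0<1 (subst (1ℚ ≤_) vv≡0 (1≤vvec·vvec n)))

-- Chambers of D_n

Chain : ∀ {n} → (ℚ → ℚ → Set) → (Fin n → ℚ) → Set
Chain {n} _R_ f = (k l : Fin n) → toℕ l ≡ suc (toℕ k) → f k R f l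

chain-tail : ∀ {n} {_R_ : ℚ → ℚ → Set} (f : Fin (suc n) → ℚ) →
             Chain _R_ f → Chain _R_ (λ k → f (F.suc k))
chain-tail f chain k l l≡1+k = chain (F.suc k) (F.suc l) (cong suc l≡1+k)

chain-mono : ∀ {n} {f : Fin n → ℚ} → Chain _≤_ f → ∀ {k l} → k F.≤ l → f k ≤ f l
chain-mono {suc n}           chain {F.zero}  {F.zero}  _           = ℚP.≤-refl
chain-mono {suc (suc n)} {f} chain {F.zero}  {F.suc l} _           = ℚP.≤-trans
  (chain F.zero (F.suc F.zero) refl) (chain-mono (chain-tail {_R_ = _≤_} f chain) {F.zero} {l} ℕ.z≤n)
chain-mono {suc n}       {f} chain {F.suc k} {F.suc l} (ℕ.s≤s k≤l) =
  chain-mono (chain-tail {_R_ = _≤_} f chain) k≤l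

unitStep : ∀ {n} → Fin n → Fin n → ℚ
unitStep F.zero    _         = 1ℚ
unitStep (F.suc k) F.zero    = 0ℚ
unitStep (F.suc k) (F.suc j) = unitStep k j

unitStep-≤ : ∀ {n} {k j : Fin n} → k F.≤ j → unitStep k j ≡ 1ℚ
unitStep-≤ {k = F.zero}                  _           = refl
unitStep-≤ {k = F.suc k} {F.suc j} (ℕ.s≤s k≤j) = unitStep-≤ k≤j

unitStep-< : ∀ {n} {k j : Fin n} → j F.< k → unitStep k j ≡ 0ℚ
unitStep-< {k = F.suc k} {F.zero}  _                = refl
unitStep-< {k = F.suc k} {F.suc j} (ℕ.s≤s j<k)      = unitStep-< j<k

0≤unitStep : ∀ {n} (k j : Fin n) → 0ℚ ≤ unitStep k j
0≤unitStep F.zero    _         = 0≤1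
0≤unitStep (F.suc k) F.zero    = ℚP.≤-refl
0≤unitStep (F.suc k) (F.suc j) = 0≤unitStep k j

∣unitStep∣≤1 : ∀ {n} (k j : Fin n) → ∣ unitStep k j ∣ ≤ 1ℚ
∣unitStep∣≤1 F.zero    _         = ℚP.≤-refl
∣unitStep∣≤1 (F.suc k) F.zero    = 0≤1
∣unitStep∣≤1 (F.suc k) (F.suc j) = ∣unitStep∣≤1 k j

unitStep-chain : ∀ {n} (k : Fin n) → Chain _≤_ (unitStep k)
unitStep-chain F.zero    _         _         _ = ℚP.≤-refl
unitStep-chain (F.suc k) F.zero    (F.suc l) _ = 0≤unitStep k l
unitStep-chain (F.suc k) (F.suc j) (F.suc l) l≡1+j = unitStep-chain k j l (ℕP.suc-injective l≡1+j)

tailSum : ∀ {n} → (Fin n → ℚ) → Fin n → ℚ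
tailSum a k = sumF (λ j → a j * unitStep k j)

abel : ∀ {r} (a s : Fin (suc r) → ℚ) → Chain _≤_ s → (∀ k → 1ℚ ≤ tailSum a (F.suc k)) →
       (tailSum a F.zero - 1ℚ) * s F.zero + s (fromℕ r) ≤ sumF (λ j → a j * s j)
abel {zero} a s _ _ = ℚP.≤-reflexive
  (solve 2 (λ a s → (a :* con 1ℚ :+ con 0ℚ :- con 1ℚ) :* s :+ s := a :* s :+ con 0ℚ) refl (a F.zero) (s F.zero))
abel {suc r} a s chain tails = begin
  (a₀ * 1ℚ + t - 1ℚ) * s₀ + sₗ  ≤⟨ ≤-by-difference ((t - 1ℚ) * (s₁ - s₀))
                                      (solve 5 (λ a₀ t s₀ s₁ sₗ → (a₀ :* s₀ :+ ((t :- con 1ℚ) :* s₁ :+ sₗ))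
                                                 :- ((a₀ :* con 1ℚ :+ t :- con 1ℚ) :* s₀ :+ sₗ)
                                                 := (t :- con 1ℚ) :* (s₁ :- s₀)) refl a₀ t s₀ s₁ sₗ)
                                      (*-nonNeg (p≤q⇒0≤q-p 1≤t) (p≤q⇒0≤q-p (chain F.zero (F.suc F.zero) refl))) ⟩
  a₀ * s₀ + ((t - 1ℚ) * s₁ + sₗ) ≤⟨ ℚP.+-monoʳ-≤ (a₀ * s₀) ih ⟩
  sumF (λ j → a j * s j)         ∎
  where
  a₀ = a F.zero
  s₀ = s F.zero
  s₁ = s (F.suc F.zero)
  sₗ = s (fromℕ (suc r))
  a′ = λ j → a (F.suc j)
  t = tailSum a′ F.zero
  drop-a₀ : ∀ k → a₀ * 0ℚ + tailSum a′ k ≡ tailSum a′ k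
  drop-a₀ k = trans (cong (_+ tailSum a′ k) (ℚP.*-zeroʳ a₀)) (ℚP.+-identityˡ _)
  1≤t : 1ℚ ≤ t
  1≤t = subst (1ℚ ≤_) (drop-a₀ F.zero) (tails F.zero)
  ih = abel a′ (λ j → s (F.suc j)) (chain-tail {_R_ = _≤_} s chain)
             (λ k → subst (1ℚ ≤_) (drop-a₀ (F.suc k)) (tails (F.suc k)))

last≤abelSum : ∀ {r} (a s : Fin (suc r) → ℚ) → Chain _≤_ s → 0ℚ ≤ s F.zero →
               (∀ k → 1ℚ ≤ tailSum a k) →
               s (fromℕ r) ≤ sumF (λ j → a j * s j)
last≤abelSum a s chain 0≤s₀ tails = ℚP.≤-trans
  (subst (_≤ (tailSum a F.zero - 1ℚ) * s F.zero + s (fromℕ _)) (ℚP.+-identityˡ (s (fromℕ _)))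
    (ℚP.+-monoˡ-≤ (s (fromℕ _)) (*-nonNeg (p≤q⇒0≤q-p (tails F.zero)) 0≤s₀)))
  (abel a s chain (λ k → tails (F.suc k)))

module Chamber (m : ℕ) (ω : Permutation′ (suc (suc m))) (ε : Fin (suc (suc m)) → Bool) where

  n = suc (suc m)

  v : Point n
  v = vvec n

  last : Fin n
  last = fromℕ (suc m)

  ct : Point n → Fin n → ℚ
  ct = chainTerm ω ε

  Chain≤ : Point n → Set
  Chain≤ x = Chain _≤_ (ct x)

  -- As |q| ≥ -q, position 0 enters the lower bound for v · x like a barred position.
  barred : Fin n → Bool
  barred F.zero    = true
  barred (F.suc k) = ε (F.suc k)

  atPositions : (Fin n → ℚ) → Point n
  atPositions b i = b (ω ⟨$⟩ˡ i)

  atPositions-ω : ∀ b j → atPositions b (ω ⟨$⟩ʳ j) ≡ b j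
  atPositions-ω b j = cong b (inverseˡ ω)

  withChain : (Fin n → ℚ) → Point n
  withChain c = atPositions (λ j → sign (barred j) * c j)

  tailPoint : Fin n → Point n
  tailPoint k = withChain (unitStep k)

  τ : Fin n → ℚ
  τ k = v · tailPoint k

  ct-suc : ∀ x j → ct x (F.suc j) ≡ sign (ε (F.suc j)) * x (ω ⟨$⟩ʳ F.suc j)
  ct-suc x j = if-neg≡sign* (ε (F.suc j)) (x (ω ⟨$⟩ʳ F.suc j))

  ct-withChain : ∀ c → 0ℚ ≤ c F.zero → ∀ j → ct (withChain c) j ≡ c j
  ct-withChain c 0≤c₀ F.zero = begin-equality
    ∣ withChain c (ω ⟨$⟩ʳ F.zero) ∣  ≡⟨ cong ∣_∣ (atPositions-ω (λ j → sign (barred j) * c j) F.zero) ⟩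
    ∣ sign true * c F.zero ∣          ≡⟨ ∣sign*p∣≡∣p∣ true (c F.zero) ⟩
    ∣ c F.zero ∣                      ≡⟨ ℚP.0≤p⇒∣p∣≡p 0≤c₀ ⟩
    c F.zero                          ∎
  ct-withChain c _ (F.suc j) = begin-equality
    ct (withChain c) (F.suc j)                  ≡⟨ ct-suc (withChain c) j ⟩
    sign b * withChain c (ω ⟨$⟩ʳ F.suc j)
      ≡⟨ cong (sign b *_) (atPositions-ω (λ j → sign (barred j) * c j) (F.suc j)) ⟩
    sign b * (sign b * c (F.suc j))             ≡⟨ sign*sign*p b (c (F.suc j)) ⟩
    c (F.suc j)                                 ∎
    where b = ε (F.suc j)

  ct-• : ∀ {l} x → 0ℚ ≤ l → ∀ j → ct (l • x) j ≡ l * ct x j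
  ct-• {l} x 0≤l F.zero =
    trans (ℚP.∣p*q∣≡∣p∣*∣q∣ l (x (ω ⟨$⟩ʳ F.zero))) (cong (_* ct x F.zero) (ℚP.0≤p⇒∣p∣≡p 0≤l))
  ct-• {l} x 0≤l (F.suc j) = begin-equality
    ct (l • x) (F.suc j)    ≡⟨ ct-suc (l • x) j ⟩
    s * (l * q)             ≡⟨ solve 3 (λ s l q → s :* (l :* q) := l :* (s :* q)) refl s l q ⟩
    l * (s * q)             ≡⟨ cong (l *_) (ct-suc x j) ⟨
    l * ct x (F.suc j)      ∎
    where
    s = sign (ε (F.suc j))
    q = x (ω ⟨$⟩ʳ F.suc j)

  ct-+ᵥ-suc : ∀ x y j → ct (x +ᵥ y) (F.suc j) ≡ ct x (F.suc j) + ct y (F.suc j)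
  ct-+ᵥ-suc x y j = trans (ct-suc (x +ᵥ y) j) (trans (ℚP.*-distribˡ-+ (sign (ε (F.suc j))) _ _)
    (sym (cong₂ _+_ (ct-suc x j) (ct-suc y j))))

  ct-+ᵥ-≤ : ∀ x y j → ct (x +ᵥ y) j ≤ ct x j + ct y j
  ct-+ᵥ-≤ x y F.zero    = ℚP.∣p+q∣≤∣p∣+∣q∣ (x (ω ⟨$⟩ʳ F.zero)) (y (ω ⟨$⟩ʳ F.zero))
  ct-+ᵥ-≤ x y (F.suc j) = ℚP.≤-reflexive (ct-+ᵥ-suc x y j)

  region-• : ∀ {l x} → 0ℚ < l → Region ω ε x → Region ω ε (l • x)
  region-• {l} {x} 0<l x∈R k k′ k′≡1+k =
    subst₂ _<_ (sym (ct-• x (ℚP.<⇒≤ 0<l) k)) (sym (ct-• x (ℚP.<⇒≤ 0<l) k′))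
    (ℚP.*-monoʳ-<-pos l {{ℚ.positive 0<l}} (x∈R k k′ k′≡1+k))

  chain≤-• : ∀ {l x} → 0ℚ ≤ l → Chain≤ x → Chain≤ (l • x)
  chain≤-• {l} {x} 0≤l x-chain k k′ k′≡1+k = subst₂ _≤_ (sym (ct-• x 0≤l k)) (sym (ct-• x 0≤l k′))
    (ℚP.*-monoˡ-≤-nonNeg l {{ℚ.nonNegative 0≤l}} (x-chain k k′ k′≡1+k))

  region-+ᵥ : ∀ {x y} → Region ω ε x → Chain≤ y → Region ω ε (x +ᵥ y)
  region-+ᵥ {x} {y} x∈R y-chain k (F.suc l) l≡1+k = begin-strict
    ct (x +ᵥ y) k                   ≤⟨ ct-+ᵥ-≤ x y k ⟩
    ct x k + ct y k                 <⟨ ℚP.+-mono-<-≤ (x∈R k (F.suc l) l≡1+k) (y-chain k (F.suc l) l≡1+k) ⟩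
    ct x (F.suc l) + ct y (F.suc l) ≡⟨ ct-+ᵥ-suc x y l ⟨
    ct (x +ᵥ y) (F.suc l)           ∎

  region⇒chain≤ : ∀ {x} → Region ω ε x → Chain≤ x
  region⇒chain≤ x∈R k l l≡1+k = ℚP.<⇒≤ (x∈R k l l≡1+k)

  0≤ct : ∀ {x} → Chain≤ x → ∀ j → 0ℚ ≤ ct x j
  0≤ct chain j = ℚP.≤-trans (ℚP.0≤∣p∣ _) (chain-mono chain {F.zero} {j} ℕ.z≤n)

  ∣x∘ω∣≤ct : ∀ {x} → Chain≤ x → ∀ j → ∣ x (ω ⟨$⟩ʳ j) ∣ ≤ ct x j
  ∣x∘ω∣≤ct         chain F.zero    = ℚP.≤-refl
  ∣x∘ω∣≤ct {x} chain (F.suc j) = ℚP.≤-reflexive (begin-equality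
    ∣ x (ω ⟨$⟩ʳ F.suc j) ∣                         ≡⟨ ∣sign*p∣≡∣p∣ (ε (F.suc j)) _ ⟨
    ∣ sign (ε (F.suc j)) * x (ω ⟨$⟩ʳ F.suc j) ∣    ≡⟨ cong ∣_∣ (ct-suc x j) ⟨
    ∣ ct x (F.suc j) ∣                             ≡⟨ ℚP.0≤p⇒∣p∣≡p (0≤ct chain (F.suc j)) ⟩
    ct x (F.suc j)                                 ∎)

  bounded-by-last : ∀ {x} → Chain≤ x → ∀ i → ∣ x i ∣ ≤ ct x last
  bounded-by-last {x} chain i = subst (λ i → ∣ x i ∣ ≤ ct x last) (inverseʳ ω)
    (ℚP.≤-trans (∣x∘ω∣≤ct chain (ω ⟨$⟩ˡ i)) (chain-mono chain (FP.≤fromℕ (ω ⟨$⟩ˡ i))))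

  weight : Fin n → ℚ
  weight j = sign (barred j) * pow2 (toℕ (ω ⟨$⟩ʳ j))

  ·-withChain : ∀ c → v · withChain c ≡ sumF (λ j → weight j * c j)
  ·-withChain c = trans (·-permute v (withChain c) ω) (sumF-cong λ j →
    trans (cong (pow2 (toℕ (ω ⟨$⟩ʳ j)) *_) (atPositions-ω (λ j → sign (barred j) * c j) j))
          (solve 3 (λ P s c → P :* (s :* c) := (s :* P) :* c)
                   refl (pow2 (toℕ (ω ⟨$⟩ʳ j))) (sign (barred j)) (c j)))

  weight*ct≤ : ∀ x j → weight j * ct x j ≤ pow2 (toℕ (ω ⟨$⟩ʳ j)) * x (ω ⟨$⟩ʳ j)
  weight*ct≤ x F.zero = ≤-by-difference (P * (q + ∣ q ∣))
    (solve 3 (λ P q a → P :* q :- (con (- 1ℚ) :* P) :* a := P :* (q :+ a)) refl P q ∣ q ∣)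
    (*-nonNeg (0≤pow2 (toℕ (ω ⟨$⟩ʳ F.zero))) (0≤p+∣p∣ q))
    where
    P = pow2 (toℕ (ω ⟨$⟩ʳ F.zero))
    q = x (ω ⟨$⟩ʳ F.zero)
  weight*ct≤ x (F.suc j) = ℚP.≤-reflexive (begin-equality
    (s * P) * ct x (F.suc j)  ≡⟨ cong ((s * P) *_) (ct-suc x j) ⟩
    (s * P) * (s * q)         ≡⟨ solve 3 (λ s P q → (s :* P) :* (s :* q) := s :* (s :* (P :* q))) refl s P q ⟩
    s * (s * (P * q))         ≡⟨ sign*sign*p (ε (F.suc j)) (P * q) ⟩
    P * q                     ∎)
    where
    s = sign (ε (F.suc j))
    P = pow2 (toℕ (ω ⟨$⟩ʳ F.suc j))
    q = x (ω ⟨$⟩ʳ F.suc j)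

  ct-last≤· : (∀ k → 1ℚ ≤ τ k) → ∀ {x} → Chain≤ x → ct x last ≤ v · x
  ct-last≤· 1≤τ {x} chain = begin
    ct x last                           ≤⟨ last≤abelSum weight (ct x) chain (ℚP.0≤∣p∣ _) 1≤tails ⟩
    sumF (λ j → weight j * ct x j)      ≤⟨ sumF-mono-≤ (weight*ct≤ x) ⟩
    sumF (λ j → pow2 (toℕ (ω ⟨$⟩ʳ j)) * x (ω ⟨$⟩ʳ j)) ≡⟨ ·-permute v x ω ⟨
    v · x                               ∎
    where
    1≤tails : ∀ k → 1ℚ ≤ tailSum weight k
    1≤tails k = subst (1ℚ ≤_) (·-withChain (unitStep k)) (1≤τ k)

  MaxFrom : Fin n → Fin n → Set
  MaxFrom k p = k F.≤ p × (∀ j → k F.≤ j → ω ⟨$⟩ʳ j F.≤ ω ⟨$⟩ʳ p)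

  ∃-MaxFrom : ∀ k → ∃ (MaxFrom k)
  ∃-MaxFrom k with ∃-largest (λ i → k FP.≤? (ω ⟨$⟩ˡ i)) (FP.≤-reflexive (sym (inverseˡ ω)))
  ... | top , k≤p , largest = ω ⟨$⟩ˡ top , k≤p , λ j k≤j →
    subst₂ F._≤_ refl (sym (inverseʳ ω)) (largest (ω ⟨$⟩ʳ j) (subst (k F.≤_) (sym (inverseˡ ω)) k≤j))

  ≤-after⇒RLMax : ∀ {p} → (∀ l → p F.< l → ω ⟨$⟩ʳ l F.≤ ω ⟨$⟩ʳ p) → RLMax ω p
  ≤-after⇒RLMax ≤ωp l p<l = ℕP.≤∧≢⇒< (≤ωp l p<l) λ ωl≡ωp →
    ℕP.<-irrefl (cong toℕ (Injection.injective (↔⇒↣ ω) (sym (FP.toℕ-injective ωl≡ωp)))) p<l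

  MaxFrom⇒RLMax : ∀ {k p} → MaxFrom k p → RLMax ω p
  MaxFrom⇒RLMax (k≤p , maximal) = ≤-after⇒RLMax (λ l p<l → maximal l (FP.≤-trans k≤p (ℕP.<⇒≤ p<l)))

  RLMax⇒MaxFrom : ∀ {p} → RLMax ω p → MaxFrom p p
  RLMax⇒MaxFrom {p} rl = FP.≤-refl , ≤ωp
    where
    ≤ωp : ∀ j → p F.≤ j → ω ⟨$⟩ʳ j F.≤ ω ⟨$⟩ʳ p
    ≤ωp j p≤j with ℕP.m≤n⇒m<n∨m≡n p≤j
    ... | inj₁ p<j = ℕP.<⇒≤ (rl j p<j)
    ... | inj₂ p≡j = FP.≤-reflexive (cong (ω ⟨$⟩ʳ_) (sym (FP.toℕ-injective p≡j)))

  tailPoint-dominated : ∀ {k p} → MaxFrom k p → 1ℚ ≤ sign (barred p) * τ k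
  tailPoint-dominated {k} {p} (k≤p , maximal) =
    top-coefficient-dominates± (tailPoint k) (ω ⟨$⟩ʳ p) (barred p) bound top above
    where
    bound : ∀ i → ∣ tailPoint k i ∣ ≤ 1ℚ
    bound i = subst (_≤ 1ℚ) (sym (∣sign*p∣≡∣p∣ (barred (ω ⟨$⟩ˡ i)) _)) (∣unitStep∣≤1 k (ω ⟨$⟩ˡ i))
    top : tailPoint k (ω ⟨$⟩ʳ p) ≡ sign (barred p) * 1ℚ
    top = trans (atPositions-ω (λ j → sign (barred j) * unitStep k j) p)
                (cong (sign (barred p) *_) (unitStep-≤ k≤p))
    above : ∀ i → ω ⟨$⟩ʳ p F.< i → tailPoint k i ≡ 0ℚ
    above i ωp<i with k FP.≤? (ω ⟨$⟩ˡ i)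
    ... | yes k≤j = ⊥-elim (ℕP.<⇒≱ ωp<i (subst (F._≤ ω ⟨$⟩ʳ p) (inverseʳ ω) (maximal _ k≤j)))
    ... | no  k≰j = trans (cong (sign (barred (ω ⟨$⟩ˡ i)) *_) (unitStep-< (ℕP.≰⇒> k≰j)))
                          (ℚP.*-zeroʳ (sign (barred (ω ⟨$⟩ˡ i))))

  1≤τ : (∀ p → RLMax ω p → barred p ≡ false) → ∀ k → 1ℚ ≤ τ k
  1≤τ unbarred k with ∃-MaxFrom k
  ... | p , p-max = subst (1ℚ ≤_) (ℚP.*-identityˡ (τ k))
    (subst (λ b → 1ℚ ≤ sign b * τ k) (unbarred p (MaxFrom⇒RLMax p-max)) (tailPoint-dominated p-max))

  τ≤0 : ∀ {p} → RLMax ω p → barred p ≡ true → τ p ≤ 0ℚ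
  τ≤0 {p} rl barred-p = subst₂ _≤_ (neg-involutive (τ p)) refl (ℚP.neg-antimono-≤ 0≤-τp)
    where
    1≤-τp : 1ℚ ≤ - 1ℚ * τ p
    1≤-τp = subst (λ b → 1ℚ ≤ sign b * τ p) barred-p (tailPoint-dominated (RLMax⇒MaxFrom rl))
    0≤-τp : 0ℚ ≤ - τ p
    0≤-τp = ℚP.≤-trans 0≤1 (subst (1ℚ ≤_) (trans (sym (ℚP.neg-distribˡ-* 1ℚ (τ p)))
                                                 (cong -_ (ℚP.*-identityˡ (τ p)))) 1≤-τp)

  ct-tailPoint : ∀ k j → ct (tailPoint k) j ≡ unitStep k j
  ct-tailPoint k = ct-withChain (unitStep k) (0≤unitStep k F.zero)

  tailPoint-chain : ∀ k → Chain≤ (tailPoint k)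
  tailPoint-chain k j l l≡1+j = subst₂ _≤_ (sym (ct-tailPoint k j)) (sym (ct-tailPoint k l))
    (unitStep-chain k j l l≡1+j)

  staircase : Point n
  staircase = withChain (λ j → pow2 (toℕ j))

  staircase∈R : Region ω ε staircase
  staircase∈R k l l≡1+k = subst₂ _<_ (sym (ct-withChain _ 0≤1 k)) (sym (ct-withChain _ 0≤1 l))
    (subst (pow2 (toℕ k) <_) (cong pow2 (sym l≡1+k))
      (<-by-difference (pow2 (toℕ k)) (solve 1 (λ P → con 2ℚ :* P :- P := P) refl (pow2 (toℕ k)))
                       (0<pow2 (toℕ k))))

  nonempty : (∀ k → 1ℚ ≤ τ k) → Nonempty (Region ω ε ∩ H v)
  nonempty 1≤τ = κ • staircase , region-• 0<κ staircase∈R , trans (·-• v κ staircase) (p/q*q≡p (v · v) A)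
    where
    A = v · staircase
    0<A : 0ℚ < A
    0<A = begin-strict
      0ℚ                          <⟨ 0<pow2 (toℕ last) ⟩
      pow2 (toℕ last)             ≡⟨ ct-withChain (λ j → pow2 (toℕ j)) 0≤1 last ⟨
      ct staircase last           ≤⟨ ct-last≤· 1≤τ (region⇒chain≤ staircase∈R) ⟩
      A                           ∎
    instance
      A≢0 = ℚP.pos⇒nonZero A {{ℚ.positive 0<A}}
      A⁻¹>0 = ℚP.1/pos⇒pos A {{ℚ.positive 0<A}}
    κ = (v · v) * 1/ A
    0<κ : 0ℚ < κ
    0<κ = *-pos (ℚP.<-≤-trans 0<1 (1≤vvec·vvec (suc m))) (ℚP.positive⁻¹ (1/ A))

  bounded : (∀ k → 1ℚ ≤ τ k) → Bounded (Region ω ε ∩ H v)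
  bounded 1≤τ = v · v , λ x (x∈R , x∈H) i →
    ℚP.≤-trans (bounded-by-last (region⇒chain≤ x∈R) i)
               (subst (ct x last ≤_) x∈H (ct-last≤· 1≤τ (region⇒chain≤ x∈R)))

  -- y is a recession direction of the closed chamber; adding to it the multiple of x that
  -- restores v · z = v · v moves z along H v without bound.
  unbounded : ∀ {x y} → Region ω ε x → H v x → Chain≤ y → ct y last ≡ 1ℚ → v · y ≤ 0ℚ →
              ¬ Bounded (Region ω ε ∩ H v)
  unbounded {x} {y} x∈R x∈H y-chain ctyₗ≡1 vy≤0 (B , bound) = ℚP.<-irrefl refl (begin-strict
    B                           ≤⟨ p≤∣p∣ B ⟩
    ∣ B ∣                       <⟨ <-by-difference 1ℚ (solve 1 (λ b → (b :+ con 1ℚ) :- b := con 1ℚ) refl ∣ B ∣) 0<1 ⟩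
    t                           ≤⟨ t≤μ ⟩
    μ                           ≤⟨ μ≤ctz ⟩
    ct z last                   ≤⟨ subst (_≤ ∣ z (ω ⟨$⟩ʳ last) ∣) (sym (ct-suc z (fromℕ m)))
                                         (sign*p≤∣p∣ (ε last) (z (ω ⟨$⟩ʳ last))) ⟩
    ∣ z (ω ⟨$⟩ʳ last) ∣         ≤⟨ bound z (z∈R , z∈H) (ω ⟨$⟩ʳ last) ⟩
    B                           ∎)
    where
    t = ∣ B ∣ + 1ℚ
    0≤t : 0ℚ ≤ t
    0≤t = +-nonNeg (ℚP.0≤∣p∣ B) 0≤1
    β = - (v · y)
    0≤β : 0ℚ ≤ β
    0≤β = ℚP.neg-antimono-≤ vy≤0
    l = 1ℚ + t * β
    μ = t * (v · v)
    0<l : 0ℚ < l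
    0<l = ℚP.<-≤-trans 0<1 (subst (_≤ l) (ℚP.+-identityʳ 1ℚ) (ℚP.+-monoʳ-≤ 1ℚ (*-nonNeg 0≤t 0≤β)))
    0≤μ : 0ℚ ≤ μ
    0≤μ = *-nonNeg 0≤t (ℚP.≤-trans 0≤1 (1≤vvec·vvec (suc m)))
    z = l • x +ᵥ μ • y
    z∈R : Region ω ε z
    z∈R = region-+ᵥ (region-• 0<l x∈R) (chain≤-• 0≤μ y-chain)
    z∈H : H v z
    z∈H = begin-equality
      v · z                           ≡⟨ ·-distrib-+ᵥ v (l • x) (μ • y) ⟩
      v · (l • x) + v · (μ • y)       ≡⟨ cong₂ _+_ (·-• v l x) (·-• v μ y) ⟩
      l * (v · x) + μ * (v · y)       ≡⟨ cong (λ a → l * a + μ * (v · y)) x∈H ⟩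
      l * (v · v) + μ * (v · y)       ≡⟨ solve 3 (λ t r w → (con 1ℚ :+ t :* (:- r)) :* w :+ (t :* w) :* r := w)
                                           refl t (v · y) (v · v) ⟩
      v · v                           ∎
    t≤μ : t ≤ μ
    t≤μ = ≤-by-difference (t * (v · v - 1ℚ))
      (solve 2 (λ t w → t :* w :- t := t :* (w :- con 1ℚ)) refl t (v · v))
      (*-nonNeg 0≤t (p≤q⇒0≤q-p (1≤vvec·vvec (suc m))))
    0≤ctx-last : 0ℚ ≤ ct x last
    0≤ctx-last = 0≤ct (region⇒chain≤ x∈R) last
    μ≤ctz : μ ≤ ct z last
    μ≤ctz = begin
      μ                                 ≡⟨ ℚP.+-identityˡ μ ⟨
      0ℚ + μ                            ≤⟨ ℚP.+-monoˡ-≤ μ (*-nonNeg (ℚP.<⇒≤ 0<l) 0≤ctx-last) ⟩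
      l * ct x last + μ                 ≡⟨ cong (l * ct x last +_) (trans (cong (μ *_) ctyₗ≡1) (ℚP.*-identityʳ μ)) ⟨
      l * ct x last + μ * ct y last     ≡⟨ cong₂ _+_ (ct-• x (ℚP.<⇒≤ 0<l) last) (ct-• y 0≤μ last) ⟨
      ct (l • x) last + ct (μ • y) last ≡⟨ ct-+ᵥ-suc (l • x) (μ • y) (fromℕ m) ⟨
      ct z last                         ∎

  boundedSection⇔unbarredRLMax : (Nonempty (Region ω ε ∩ H v) × Bounded (Region ω ε ∩ H v))
              ⇔ (∀ p → RLMax ω p → barred p ≡ false)
  boundedSection⇔unbarredRLMax = mk⇔ unbarred (λ h → nonempty (1≤τ h) , bounded (1≤τ h))
    where
    unbarred : Nonempty (Region ω ε ∩ H v) × Bounded (Region ω ε ∩ H v) → ∀ p → RLMax ω p → barred p ≡ false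
    unbarred ((x , x∈R , x∈H) , bnd) p rl with barred p in barred-p
    ... | false = refl
    ... | true  = ⊥-elim (unbounded x∈R x∈H (tailPoint-chain p)
                            (trans (ct-tailPoint p last) (unitStep-≤ (FP.≤fromℕ p)))
                            (τ≤0 rl barred-p) bnd)

  RLMax-zero⇒top : RLMax ω F.zero → ω ⟨$⟩ʳ F.zero ≡ last
  RLMax-zero⇒top rl with ω ⟨$⟩ˡ last in ω⁻¹last≡
  ... | F.zero  = trans (cong (ω ⟨$⟩ʳ_) (sym ω⁻¹last≡)) (inverseʳ ω)
  ... | F.suc q = ⊥-elim (ℕP.<⇒≱ (rl (F.suc q) (ℕ.s≤s ℕ.z≤n))
                    (subst (ω ⟨$⟩ʳ F.zero F.≤_) (sym ω[1+q]≡last) (FP.≤fromℕ (ω ⟨$⟩ʳ F.zero))))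
    where
    ω[1+q]≡last : ω ⟨$⟩ʳ F.suc q ≡ last
    ω[1+q]≡last = trans (cong (ω ⟨$⟩ʳ_) (sym ω⁻¹last≡)) (inverseʳ ω)

  top⇒RLMax : ∀ {p} → ω ⟨$⟩ʳ p ≡ last → RLMax ω p
  top⇒RLMax ωp≡last = ≤-after⇒RLMax λ l _ → subst (ω ⟨$⟩ʳ l F.≤_) (sym ωp≡last) (FP.≤fromℕ (ω ⟨$⟩ʳ l))

  condition⇔unbarredRLMax : ((ω ⟨$⟩ʳ F.zero ≢ last) × (∀ k → RLMax ω k → ε k ≡ false))
                        ⇔ (∀ p → RLMax ω p → barred p ≡ false)
  condition⇔unbarredRLMax = mk⇔ to from
    where
    true≢false : true ≢ false
    true≢false ()
    to : (ω ⟨$⟩ʳ F.zero ≢ last) × (∀ k → RLMax ω k → ε k ≡ false) →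
         ∀ p → RLMax ω p → barred p ≡ false
    to (ω₀≢last , _)     F.zero    rl = ⊥-elim (ω₀≢last (RLMax-zero⇒top rl))
    to (_ , rl-unbarred) (F.suc p) rl = rl-unbarred (F.suc p) rl
    from : (∀ p → RLMax ω p → barred p ≡ false) →
           (ω ⟨$⟩ʳ F.zero ≢ last) × (∀ k → RLMax ω k → ε k ≡ false)
    from unbarred = (λ ω₀≡last → true≢false (unbarred F.zero (top⇒RLMax ω₀≡last))) , λ where
      F.zero    rl → ⊥-elim (true≢false (unbarred F.zero rl))
      (F.suc k) rl → unbarred (F.suc k) rl

proposition8p3 : (m : ℕ) →
    GenericDn (suc (suc m)) (H (vvec (suc (suc m))))
    × ((ω : Permutation′ (suc (suc m))) (ε : Fin (suc (suc m)) → Bool) → InDn ω ε →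
        ((Nonempty (Region ω ε ∩ H (vvec (suc (suc m))))
          × Bounded (Region ω ε ∩ H (vvec (suc (suc m)))))
         ⇔ ((ω ⟨$⟩ʳ F.zero ≢ fromℕ (suc m))
            × ((k : Fin (suc (suc m))) → RLMax ω k → ε k ≡ false))))
proposition8p3 m = vvec-generic (suc m) , λ ω ε _ →
  ⇔.trans (Chamber.boundedSection⇔unbarredRLMax m ω ε) (⇔.sym (Chamber.condition⇔unbarredRLMax m ω ε))
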